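{- Let $G$ be a $d$-regular bipartite graph with $2n$ vertices. Then the vertex set of $G$ can be partitioned so that the corresponding induced subgraphs $G_1=(P_1,Q_1,E_1),\dots,G_k=(P_k,Q_k,E_k)$, with $k\le 4n/d+1$, satisfy: (1) the minimum cut in each $G_i$ is at least $d/8$; (2) $\sum_{i=1}^{k}|\delta_G(V(G_i))|\le 2n$.
   Context: $\delta_G(X)$ denotes the set of edges of $G$ with exactly one endpoint in $X$. The minimum cut of a graph with a single vertex is taken to be $+\infty$. -}

module Defs where

open import Data.Nat using (ℕ; zero; suc; _+_; _*_; _≤_)
open import Data.Fin using (Fin; zero; suc; _≟_)
open import Data.Bool using (Bool; true; false; _∧_; not; if_then_else_)
open import Data.Product using (∃; _×_)
open import Relation.Nullary.Decidable using (does)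
open import Relation.Binary.PropositionalEquality using (_≡_; _≢_)

sumFin : ∀ {m} → (Fin m → ℕ) → ℕ
sumFin {zero}  f = 0
sumFin {suc m} f = f zero + sumFin (λ i → f (suc i))

count : ∀ {m} → (Fin m → Bool) → ℕ
count f = sumFin (λ i → if f i then 1 else 0)

record Graph (m : ℕ) : Set where
  field
    adj    : Fin m → Fin m → Bool
    sym    : ∀ u v → adj u v ≡ adj v u
    irrefl : ∀ v → adj v v ≡ false
open Graph public

degree : ∀ {m} → Graph m → Fin m → ℕ
degree G v = count (adj G v)

Regular : ∀ {m} → Graph m → ℕ → Set
Regular G d = ∀ v → degree G v ≡ d

Bipartite : ∀ {m} → Graph m → Set
Bipartite {m} G = ∃ λ (c : Fin m → Bool) → ∀ u v → adj G u v ≡ true → c u ≢ c v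

-- number of edges with one endpoint in X and the other in Y (X, Y disjoint)
edgesBetween : ∀ {m} → Graph m → (Fin m → Bool) → (Fin m → Bool) → ℕ
edgesBetween G X Y = sumFin (λ u → if X u then count (λ v → Y v ∧ adj G u v) else 0)

boundary : ∀ {m} → Graph m → (Fin m → Bool) → ℕ
boundary G X = edgesBetween G X (λ v → not (X v))

NonEmpty : ∀ {m} → (Fin m → Bool) → Set
NonEmpty X = ∃ λ v → X v ≡ true

-- "the minimum cut of the induced subgraph G[W] is at least a / b":
-- every cut (S, W \ S) with both sides nonempty has at least a / b edges of G[W]
-- crossing it (a single-vertex W has no such cut: minimum cut = +∞).
MinCutAtLeast : ∀ {m} → Graph m → (Fin m → Bool) → ℕ → ℕ → Set
MinCutAtLeast G W a b =
  ∀ (S : _ → Bool) →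
    NonEmpty (λ v → W v ∧ S v) →
    NonEmpty (λ v → W v ∧ not (S v)) →
    a ≤ b * edgesBetween G (λ v → W v ∧ S v) (λ v → W v ∧ not (S v))

part : ∀ {m k} → (Fin m → Fin k) → Fin k → Fin m → Bool
part p i v = does (p v ≟ i)

-- Starting from the partition with a single class, repeatedly split a class W along a cut
-- (S, W ∖ S) of fewer than d/8 edges. A split adds one class and raises Σᵢ |δ(Vᵢ)| by twice the
-- cut, so 4 Σᵢ |δ(Vᵢ)| ≤ d k is preserved; as classes stay nonempty there are at most 2n splits, and
-- when none is possible every class has minimum cut at least d/8. On the other hand, a class W with
-- a vertices on one side of the bipartition and b on the other has |δ(W)| ≥ a(d − b) + b(d − a),
-- so d ≤ |δ(W)| + |W|; summing over the classes gives d k ≤ Σᵢ |δ(Vᵢ)| + 2n. Together with the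
-- invariant this yields Σᵢ |δ(Vᵢ)| ≤ 2n and d k ≤ 4n.
module Submission where

open import Defs hiding (sym)
open import Data.Bool as Bool using (Bool; true; false; _∧_; not; if_then_else_)
open import Data.Bool.Properties using (∧-conicalˡ; ∧-conicalʳ; not-injective; not-involutive)
open import Data.Empty using (⊥-elim)
open import Data.Fin using (Fin; zero; suc; _≟_)
open import Data.Fin.Properties using (any?; injective⇒≤)
open import Data.Fin.Subset.Properties using (anySubset?)
open import Data.Nat using (ℕ; zero; suc; _+_; _*_; _≤_; _<_; _∸_; z≤n; s≤s; _<?_)
open import Data.Nat.Properties hiding (_≟_)
open import Data.Nat.Tactic.RingSolver using (solve-∀)
open import Algebra.Properties.CommutativeSemigroup +-commutativeSemigroup using (interchange)
open import Data.Product using (∃; _×_; _,_; proj₁; proj₂)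
open import Data.Vec using (lookup; tabulate)
open import Data.Vec.Properties using (lookup∘tabulate)
open import Function.Base using (_∘_)
open import Function.Definitions using (StrictlySurjective)
open import Relation.Binary.PropositionalEquality
open import Relation.Nullary using (¬_; Dec; yes; no)
open import Relation.Nullary.Decidable using (does; dec-true; map′; _×-dec_)

⟦_⟧ : Bool → ℕ
⟦ b ⟧ = if b then 1 else 0

sumFin-cong : ∀ {m} {f g : Fin m → ℕ} → (∀ i → f i ≡ g i) → sumFin f ≡ sumFin g
sumFin-cong {zero}  f≗g = refl
sumFin-cong {suc m} f≗g = cong₂ _+_ (f≗g zero) (sumFin-cong (f≗g ∘ suc))

sumFin-mono : ∀ {m} {f g : Fin m → ℕ} → (∀ i → f i ≤ g i) → sumFin f ≤ sumFin g
sumFin-mono {zero}  f≤g = z≤n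
sumFin-mono {suc m} f≤g = +-mono-≤ (f≤g zero) (sumFin-mono (f≤g ∘ suc))

sumFin-zero : ∀ m → sumFin {m} (λ _ → 0) ≡ 0
sumFin-zero zero    = refl
sumFin-zero (suc m) = sumFin-zero m

sumFin-const : ∀ m c → sumFin {m} (λ _ → c) ≡ m * c
sumFin-const zero    c = refl
sumFin-const (suc m) c = cong (c +_) (sumFin-const m c)

sumFin-+ : ∀ {m} (f g : Fin m → ℕ) → sumFin (λ i → f i + g i) ≡ sumFin f + sumFin g
sumFin-+ {zero}  f g = refl
sumFin-+ {suc m} f g =
  trans (cong (f zero + g zero +_) (sumFin-+ (f ∘ suc) (g ∘ suc))) (interchange (f zero) (g zero) _ _)

sumFin-+₃ : ∀ {m} (f g h : Fin m → ℕ) →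
  sumFin (λ i → f i + g i + h i) ≡ sumFin f + sumFin g + sumFin h
sumFin-+₃ f g h = trans (sumFin-+ (λ i → f i + g i) h) (cong (_+ sumFin h) (sumFin-+ f g))

sumFin-comm : ∀ {m k} (f : Fin m → Fin k → ℕ) →
  sumFin (λ i → sumFin (f i)) ≡ sumFin (λ j → sumFin (λ i → f i j))
sumFin-comm {zero}  {k} f = sym (sumFin-zero k)
sumFin-comm {suc m} {k} f =
  trans (cong (sumFin (f zero) +_) (sumFin-comm (f ∘ suc)))
        (sym (sumFin-+ (f zero) (λ j → sumFin (λ i → f (suc i) j))))

sumFin-δ : ∀ {k} (x : Fin k) (g : Fin k → ℕ) → sumFin (λ i → if does (x ≟ i) then g i else 0) ≡ g x
sumFin-δ {suc k} zero    g = trans (cong (g zero +_) (sumFin-zero k)) (+-identityʳ (g zero))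
sumFin-δ {suc k} (suc x) g = sumFin-δ x (g ∘ suc)

sumFin-if-split : ∀ {m} (X Y : Fin m → Bool) (f : Fin m → ℕ) →
  sumFin (λ u → if X u then f u else 0) ≡
  sumFin (λ u → if X u ∧ Y u then f u else 0) + sumFin (λ u → if X u ∧ not (Y u) then f u else 0)
sumFin-if-split X Y f =
  trans (sumFin-cong split)
        (sumFin-+ (λ u → if X u ∧ Y u then f u else 0) (λ u → if X u ∧ not (Y u) then f u else 0))
  where
  split : ∀ u → (if X u then f u else 0) ≡
                (if X u ∧ Y u then f u else 0) + (if X u ∧ not (Y u) then f u else 0)
  split u with X u | Y u
  ... | true  | true  = sym (+-identityʳ (f u))
  ... | true  | false = refl
  ... | false | _     = refl

count-split : ∀ {m} (X f : Fin m → Bool) →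
  count f ≡ count (λ v → X v ∧ f v) + count (λ v → not (X v) ∧ f v)
count-split X f =
  trans (sumFin-cong split) (sumFin-+ (λ v → ⟦ X v ∧ f v ⟧) (λ v → ⟦ not (X v) ∧ f v ⟧))
  where
  split : ∀ v → ⟦ f v ⟧ ≡ ⟦ X v ∧ f v ⟧ + ⟦ not (X v) ∧ f v ⟧
  split v with X v
  ... | true  = sym (+-identityʳ ⟦ f v ⟧)
  ... | false = refl

count-mono : ∀ {m} {f g : Fin m → Bool} → (∀ v → f v ≡ true → g v ≡ true) → count f ≤ count g
count-mono {f = f} {g} f⇒g = sumFin-mono pointwise
  where
  pointwise : ∀ v → ⟦ f v ⟧ ≤ ⟦ g v ⟧
  pointwise v with f v in fv
  ... | true  rewrite f⇒g v fv = ≤-refl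
  ... | false = z≤n

count-pos : ∀ {m} (f : Fin m → Bool) → NonEmpty f → 0 < count f
count-pos {suc m} f (zero  , fv) rewrite fv = s≤s z≤n
count-pos {suc m} f (suc v , fv) = ≤-trans (count-pos (f ∘ suc) (v , fv)) (m≤n+m _ _)

count*≤sumFin : ∀ {m} (f : Fin m → Bool) (x : Fin m → ℕ) y →
  (∀ u → f u ≡ true → y ≤ x u) → count f * y ≤ sumFin (λ u → if f u then x u else 0)
count*≤sumFin {zero}  f x y y≤x = z≤n
count*≤sumFin {suc m} f x y y≤x with f zero in f0
... | true  = +-mono-≤ (y≤x zero f0) (count*≤sumFin (f ∘ suc) (x ∘ suc) y (y≤x ∘ suc))
... | false = count*≤sumFin (f ∘ suc) (x ∘ suc) y (y≤x ∘ suc)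

sumFin-count-part : ∀ {m k} (p : Fin m → Fin k) → sumFin (λ i → count (part p i)) ≡ m
sumFin-count-part {m} p = begin
  sumFin (λ i → count (part p i))             ≡⟨ sumFin-comm (λ i v → ⟦ part p i v ⟧) ⟩
  sumFin (λ v → sumFin λ i → ⟦ part p i v ⟧)  ≡⟨ sumFin-cong (λ v → sumFin-δ (p v) (λ _ → 1)) ⟩
  sumFin {m} (λ _ → 1)                        ≡⟨ sumFin-const m 1 ⟩
  m * 1                                       ≡⟨ *-identityʳ m ⟩
  m                                           ∎
  where open ≡-Reasoning

nonEmpty? : ∀ {m} (f : Fin m → Bool) → Dec (NonEmpty f)
nonEmpty? f = any? (λ v → f v Bool.≟ true)

NonEmpty-resp : ∀ {m} {f g : Fin m → Bool} → (∀ v → f v ≡ g v) → NonEmpty f → NonEmpty g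
NonEmpty-resp f≗g (v , fv) = v , trans (sym (f≗g v)) fv

edgesBetween-cong : ∀ {m} (G : Graph m) {X X′ Y Y′ : Fin m → Bool} →
  (∀ v → X v ≡ X′ v) → (∀ v → Y v ≡ Y′ v) → edgesBetween G X Y ≡ edgesBetween G X′ Y′
edgesBetween-cong G X≗X′ Y≗Y′ = sumFin-cong λ u →
  cong₂ (λ x c → if x then c else 0) (X≗X′ u)
        (sumFin-cong λ v → cong (λ y → ⟦ y ∧ adj G u v ⟧) (Y≗Y′ v))

-- Boundaries in regular bipartite graphs

ProperColouring : ∀ {m} → Graph m → (Fin m → Bool) → Set
ProperColouring G c = ∀ u v → adj G u v ≡ true → c u ≢ c v

not-proper : ∀ {m} (G : Graph m) {c} → ProperColouring G c → ProperColouring G (not ∘ c)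
not-proper G proper u v uv = proper u v uv ∘ not-injective

outDegree : ∀ {m} → Graph m → (Fin m → Bool) → Fin m → ℕ
outDegree G W u = count (λ v → not (W v) ∧ adj G u v)

module ColourClass {m} (G : Graph m) {d} (regular : Regular G d)
                   {c : Fin m → Bool} (proper : ProperColouring G c) (W : Fin m → Bool) where

  neighbours≤oppositeClass : ∀ {u} → c u ≡ true →
    count (λ v → W v ∧ adj G u v) ≤ count (λ v → W v ∧ not (c v))
  neighbours≤oppositeClass {u} cu = count-mono opposite
    where
    opposite : ∀ v → W v ∧ adj G u v ≡ true → W v ∧ not (c v) ≡ true
    opposite v _ with W v | adj G u v in uv | c v in cv
    ... | true | true | false = refl
    ... | true | true | true  = ⊥-elim (proper u v uv (trans cu (sym cv)))

  outDegree≥ : ∀ {u} → c u ≡ true → d ∸ count (λ v → W v ∧ not (c v)) ≤ outDegree G W u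
  outDegree≥ {u} cu = m≤n+o⇒m∸n≤o d _ (begin
    d                                                ≡⟨ sym (regular u) ⟩
    count (adj G u)                                  ≡⟨ count-split W (adj G u) ⟩
    count (λ v → W v ∧ adj G u v) + outDegree G W u  ≤⟨ +-monoˡ-≤ _ (neighbours≤oppositeClass cu) ⟩
    count (λ v → W v ∧ not (c v)) + outDegree G W u  ∎)
    where open ≤-Reasoning

  colourClass-outDegree≥ : count (λ v → W v ∧ c v) * (d ∸ count (λ v → W v ∧ not (c v))) ≤
                           sumFin (λ u → if W u ∧ c u then outDegree G W u else 0)
  colourClass-outDegree≥ =
    count*≤sumFin _ (outDegree G W) _ λ u Wu∧cu → outDegree≥ (∧-conicalʳ (W u) (c u) Wu∧cu)

d≤a*[d∸b]+b*[d∸a]+[a+b] : ∀ d a b → 0 < a + b → d ≤ a * (d ∸ b) + b * (d ∸ a) + (a + b)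
d≤a*[d∸b]+b*[d∸a]+[a+b] d zero (suc b) _ = ≤-trans (m≤n*m d (suc b)) (m≤m+n _ _)
d≤a*[d∸b]+b*[d∸a]+[a+b] d a@(suc _) b _ = begin
  d                                     ≤⟨ m≤n+m∸n d b ⟩
  b + (d ∸ b)                           ≡⟨ +-comm b (d ∸ b) ⟩
  (d ∸ b) + b                           ≤⟨ +-mono-≤ (m≤n*m (d ∸ b) a) (m≤n+m b a) ⟩
  a * (d ∸ b) + (a + b)                 ≤⟨ +-monoˡ-≤ (a + b) (m≤m+n _ _) ⟩
  a * (d ∸ b) + b * (d ∸ a) + (a + b)   ∎
  where open ≤-Reasoning

module _ {m} (G : Graph m) {d} (regular : Regular G d)
         {c : Fin m → Bool} (proper : ProperColouring G c) (W : Fin m → Bool) where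

  private
    a b : ℕ
    a = count (λ v → W v ∧ c v)
    b = count (λ v → W v ∧ not (c v))

  boundary≥ : a * (d ∸ b) + b * (d ∸ a) ≤ boundary G W
  boundary≥ = begin
    a * (d ∸ b) + b * (d ∸ a)
      ≤⟨ +-mono-≤ (ColourClass.colourClass-outDegree≥ G regular proper W)
                  (subst (λ a′ → b * (d ∸ a′) ≤ sumFin (λ u → if W u ∧ not (c u) then outDegree G W u else 0))
                         notnot (ColourClass.colourClass-outDegree≥ G regular (not-proper G proper) W)) ⟩
    sumFin (λ u → if W u ∧ c u then outDegree G W u else 0) +
    sumFin (λ u → if W u ∧ not (c u) then outDegree G W u else 0)
      ≡⟨ sym (sumFin-if-split W c (outDegree G W)) ⟩
    boundary G W ∎
    where
    open ≤-Reasoning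
    notnot : count (λ v → W v ∧ not (not (c v))) ≡ a
    notnot = sumFin-cong λ v → cong (λ x → ⟦ W v ∧ x ⟧) (not-involutive (c v))

  d≤boundary+count : NonEmpty W → d ≤ boundary G W + count W
  d≤boundary+count W≠∅ = begin
    d                                     ≤⟨ d≤a*[d∸b]+b*[d∸a]+[a+b] d a b (subst (0 <_) |W| (count-pos W W≠∅)) ⟩
    a * (d ∸ b) + b * (d ∸ a) + (a + b)   ≤⟨ +-mono-≤ boundary≥ (≤-reflexive (sym |W|)) ⟩
    boundary G W + count W                ∎
    where
    open ≤-Reasoning
    |W| : count W ≡ a + b
    |W| = sumFin-if-split W c (λ _ → 1)

-- Refining a partition

relabel : ∀ {k} → Fin k → Bool → Fin (suc k)
relabel x true  = zero
relabel x false = suc x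

relabel-≟ : ∀ {k} (x y : Fin k) (b b′ : Bool) →
  does (relabel y b′ ≟ relabel x b) ≡ (if b then b′ else not b′ ∧ does (y ≟ x))
relabel-≟ x y true  true  = refl
relabel-≟ x y true  false = refl
relabel-≟ x y false true  = refl
relabel-≟ x y false false = refl

refine : ∀ {m k} → (Fin m → Fin k) → Fin k → (Fin m → Bool) → Fin m → Fin (suc k)
refine p i S v = relabel (p v) (part p i v ∧ S v)

part≡true⇒≡ : ∀ {m k} (p : Fin m → Fin k) {i v} → part p i v ≡ true → p v ≡ i
part≡true⇒≡ p {i} {v} _ with p v ≟ i
... | yes pv≡i = pv≡i

x∧not[y]≡true⇒x∧y≡false : ∀ x y → x ∧ not y ≡ true → x ∧ y ≡ false
x∧not[y]≡true⇒x∧y≡false true false _ = refl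

refine-surjective : ∀ {m k} {p : Fin m → Fin k} {i S} → StrictlySurjective _≡_ p →
  NonEmpty (λ v → part p i v ∧ S v) → NonEmpty (λ v → part p i v ∧ not (S v)) →
  StrictlySurjective _≡_ (refine p i S)
refine-surjective {p = p} _ (v , Xv) _ zero = v , cong (relabel (p v)) Xv
refine-surjective {p = p} {i} {S} surj _ (w , Yw) (suc j) with surj j
... | v , refl with part p i v ∧ S v in Xv
...   | false = v , cong (relabel (p v)) Xv
...   | true  = w , (begin
  relabel (p w) (part p i w ∧ S w)  ≡⟨ cong (relabel (p w)) (x∧not[y]≡true⇒x∧y≡false (part p i w) (S w) Yw) ⟩
  suc (p w)                         ≡⟨ cong suc (trans (part≡true⇒≡ p (∧-conicalˡ _ _ Yw))
                                                       (sym (part≡true⇒≡ p (∧-conicalˡ _ _ Xv)))) ⟩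
  suc (p v)                         ∎)
  where open ≡-Reasoning

surjective⇒≤ : ∀ {m k} {p : Fin m → Fin k} → StrictlySurjective _≡_ p → k ≤ m
surjective⇒≤ {p = p} surj = injective⇒≤ {f = proj₁ ∘ surj} λ {i} {j} eq →
  trans (sym (proj₂ (surj i))) (trans (cong p eq) (proj₂ (surj j)))

private
  n≡n+0+0 : ∀ n → n ≡ n + 0 + 0
  n≡n+0+0 n = sym (trans (+-identityʳ (n + 0)) (+-identityʳ n))

-- After splitting class i along S, two adjacent vertices with labels x and y are separated exactly
-- when they were before, or when both lie in class i on different sides of S.
relabel-separates : ∀ {k} (x y i : Fin k) (su sv a : Bool) →
  ⟦ not (does (relabel y (does (y ≟ i) ∧ sv) ≟ relabel x (does (x ≟ i) ∧ su))) ∧ a ⟧ ≡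
  ⟦ not (does (y ≟ x)) ∧ a ⟧ + ⟦ (does (x ≟ i) ∧ su) ∧ ((does (y ≟ i) ∧ not sv) ∧ a) ⟧
                             + ⟦ (does (y ≟ i) ∧ sv) ∧ ((does (x ≟ i) ∧ not su) ∧ a) ⟧
relabel-separates x y i su sv a
  rewrite relabel-≟ x y (does (x ≟ i) ∧ su) (does (y ≟ i) ∧ sv)
  with y ≟ x | x ≟ i | y ≟ i | su | sv
... | yes refl | yes _    | yes _    | true  | true  = refl
... | yes refl | yes _    | yes _    | true  | false = sym (+-identityʳ ⟦ a ⟧)
... | yes refl | yes _    | yes _    | false | true  = refl
... | yes refl | yes _    | yes _    | false | false = refl
... | yes refl | no _     | no _     | _     | _     = refl
... | yes refl | yes x≡i  | no x≢i   | _     | _     = ⊥-elim (x≢i x≡i)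
... | yes refl | no x≢i   | yes x≡i  | _     | _     = ⊥-elim (x≢i x≡i)
... | no y≢x   | yes refl | yes refl | _     | _     = ⊥-elim (y≢x refl)
... | no _     | yes _    | no _     | true  | _     = n≡n+0+0 ⟦ a ⟧
... | no _     | yes _    | no _     | false | _     = n≡n+0+0 ⟦ a ⟧
... | no _     | no _     | yes _    | _     | true  = n≡n+0+0 ⟦ a ⟧
... | no _     | no _     | yes _    | _     | false = n≡n+0+0 ⟦ a ⟧
... | no _     | no _     | no _     | _     | _     = n≡n+0+0 ⟦ a ⟧

module _ {m} (G : Graph m) where

  cut : (W S : Fin m → Bool) → ℕ
  cut W S = edgesBetween G (λ v → W v ∧ S v) (λ v → W v ∧ not (S v))

  -- Counts every edge between two classes once from each endpoint.
  crossings : ∀ {k} → (Fin m → Fin k) → ℕ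
  crossings p = sumFin λ u → count λ v → not (does (p v ≟ p u)) ∧ adj G u v

  sumFin-boundary≡crossings : ∀ {k} (p : Fin m → Fin k) →
    sumFin (λ i → boundary G (part p i)) ≡ crossings p
  sumFin-boundary≡crossings p =
    trans (sumFin-comm λ i u → if part p i u then count (λ v → not (part p i v) ∧ adj G u v) else 0)
          (sumFin-cong λ u → sumFin-δ (p u) λ i → count (λ v → not (part p i v) ∧ adj G u v))

  edgesBetween≡sumFin² : ∀ X Y →
    edgesBetween G X Y ≡ sumFin λ u → sumFin λ v → ⟦ X u ∧ (Y v ∧ adj G u v) ⟧
  edgesBetween≡sumFin² X Y = sumFin-cong row
    where
    row : ∀ u → (if X u then count (λ v → Y v ∧ adj G u v) else 0) ≡
                sumFin λ v → ⟦ X u ∧ (Y v ∧ adj G u v) ⟧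
    row u with X u
    ... | true  = refl
    ... | false = sym (sumFin-zero m)

  edgesBetween≡sumFin²ᵀ : ∀ X Y →
    edgesBetween G X Y ≡ sumFin λ u → sumFin λ v → ⟦ X v ∧ (Y u ∧ adj G u v) ⟧
  edgesBetween≡sumFin²ᵀ X Y =
    trans (edgesBetween≡sumFin² X Y)
          (trans (sumFin-cong λ u → sumFin-cong λ v → cong (λ e → ⟦ X u ∧ (Y v ∧ e) ⟧) (Graph.sym G u v))
                 (sumFin-comm λ u v → ⟦ X u ∧ (Y v ∧ adj G v u) ⟧))

  crossings-refine : ∀ {k} (p : Fin m → Fin k) i S →
    crossings (refine p i S) ≡ crossings p + cut (part p i) S + cut (part p i) S
  crossings-refine p i S = begin
    crossings (refine p i S)
      ≡⟨ sumFin-cong (λ u → sumFin-cong λ v → relabel-separates (p u) (p v) i (S u) (S v) (adj G u v)) ⟩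
    sumFin (λ u → sumFin λ v → T u v + E u v + Eᵀ u v)
      ≡⟨ sumFin-cong (λ u → sumFin-+₃ (T u) (E u) (Eᵀ u)) ⟩
    sumFin (λ u → sumFin (T u) + sumFin (E u) + sumFin (Eᵀ u))
      ≡⟨ sumFin-+₃ (λ u → sumFin (T u)) (λ u → sumFin (E u)) (λ u → sumFin (Eᵀ u)) ⟩
    crossings p + sumFin (λ u → sumFin (E u)) + sumFin (λ u → sumFin (Eᵀ u))
      ≡⟨ sym (cong₂ (λ e eᵀ → crossings p + e + eᵀ) (edgesBetween≡sumFin² X Y) (edgesBetween≡sumFin²ᵀ X Y)) ⟩
    crossings p + cut (part p i) S + cut (part p i) S ∎
    where
    open ≡-Reasoning
    X Y : Fin m → Bool
    X v = part p i v ∧ S v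
    Y v = part p i v ∧ not (S v)
    T E Eᵀ : Fin m → Fin m → ℕ
    T u v = ⟦ not (does (p v ≟ p u)) ∧ adj G u v ⟧
    E u v = ⟦ X u ∧ (Y v ∧ adj G u v) ⟧
    Eᵀ u v = ⟦ X v ∧ (Y u ∧ adj G u v) ⟧

coarsestPartition : ∀ {m} (G : Graph m) →
  ∃ λ k → ∃ λ (p : Fin m → Fin k) → StrictlySurjective _≡_ p × crossings G p ≡ 0
coarsestPartition {zero}  G = 0 , (λ ()) , (λ ()) , refl
coarsestPartition {suc m} G = 1 , (λ _ → zero) , (λ { zero → zero , refl }) ,
  trans (sumFin-cong {suc m} λ _ → sumFin-zero (suc m)) (sumFin-zero (suc m))

-- The refinement process

module Refinement {m} (G : Graph m) (a b : ℕ) where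

  SparseCut : (W S : Fin m → Bool) → Set
  SparseCut W S = NonEmpty (λ v → W v ∧ S v) × NonEmpty (λ v → W v ∧ not (S v)) × b * cut G W S < a

  SparseCut-resp : ∀ {W S S′} → (∀ v → S v ≡ S′ v) → SparseCut W S → SparseCut W S′
  SparseCut-resp {W} S≗S′ (WS≠∅ , W¬S≠∅ , sparse) =
      NonEmpty-resp (λ v → cong (W v ∧_) (S≗S′ v)) WS≠∅
    , NonEmpty-resp (λ v → cong (λ s → W v ∧ not s) (S≗S′ v)) W¬S≠∅
    , subst (λ e → b * e < a)
            (edgesBetween-cong G (λ v → cong (W v ∧_) (S≗S′ v)) (λ v → cong (λ s → W v ∧ not s) (S≗S′ v)))
            sparse

  sparseCut? : ∀ W → Dec (∃ (SparseCut W))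
  sparseCut? W = map′ (λ (T , sparse) → lookup T , sparse)
                      (λ (S , sparse) → tabulate S , SparseCut-resp (sym ∘ lookup∘tabulate S) sparse)
                      (anySubset? λ T → sparseCut-at? (lookup T))
    where
    sparseCut-at? : ∀ S → Dec (SparseCut W S)
    sparseCut-at? S = nonEmpty? _ ×-dec nonEmpty? _ ×-dec (b * cut G W S <? a)

  ¬sparseCut⇒minCutAtLeast : ∀ {W} → ¬ ∃ (SparseCut W) → MinCutAtLeast G W a b
  ¬sparseCut⇒minCutAtLeast ¬sparse S WS≠∅ W¬S≠∅ = ≮⇒≥ λ sparse → ¬sparse (S , WS≠∅ , W¬S≠∅ , sparse)

  Clustering : Set
  Clustering = ∃ λ k → ∃ λ (p : Fin m → Fin k) →
    StrictlySurjective _≡_ p × b * crossings G p ≤ 2 * (a * k) × (∀ i → MinCutAtLeast G (part p i) a b)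

  crossings-step : ∀ {C e k} → b * C ≤ 2 * (a * k) → b * e < a → b * (C + e + e) ≤ 2 * (a * suc k)
  crossings-step {C} {e} {k} bC≤2ak be<a = begin
    b * (C + e + e)          ≡⟨ distrib b C e ⟩
    b * C + b * e + b * e    ≤⟨ +-mono-≤ (+-mono-≤ bC≤2ak (<⇒≤ be<a)) (<⇒≤ be<a) ⟩
    2 * (a * k) + a + a      ≡⟨ collect a k ⟩
    2 * (a * suc k)          ∎
    where
    open ≤-Reasoning
    distrib : ∀ b C e → b * (C + e + e) ≡ b * C + b * e + b * e
    distrib = solve-∀
    collect : ∀ a k → 2 * (a * k) + a + a ≡ 2 * (a * suc k)
    collect = solve-∀

  -- The fuel cannot run out: every class is nonempty, so k ≤ m.
  refineUntilDense : ∀ fuel {k} (p : Fin m → Fin k) → StrictlySurjective _≡_ p →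
    b * crossings G p ≤ 2 * (a * k) → m < k + fuel → Clustering
  refineUntilDense zero {k} p surj _ m<k+0 =
    ⊥-elim (<⇒≱ (subst (m <_) (+-identityʳ k) m<k+0) (surjective⇒≤ surj))
  refineUntilDense (suc fuel) {k} p surj bC≤2ak m<k+1+fuel with any? (λ i → sparseCut? (part p i))
  ... | no ¬sparse =
    k , p , surj , bC≤2ak , λ i → ¬sparseCut⇒minCutAtLeast λ sparse → ¬sparse (i , sparse)
  ... | yes (i , S , WS≠∅ , W¬S≠∅ , sparse) =
    refineUntilDense fuel (refine p i S) (refine-surjective surj WS≠∅ W¬S≠∅)
      (subst (λ C → b * C ≤ 2 * (a * suc k)) (sym (crossings-refine G p i S))
             (crossings-step bC≤2ak sparse))
      (subst (m <_) (+-suc k fuel) m<k+1+fuel)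

  clustering : Clustering
  clustering with coarsestPartition G
  ... | k , p , surj , C≡0 =
    refineUntilDense (suc m) p surj
      (subst (_≤ 2 * (a * k)) (sym (trans (cong (b *_) C≡0) (*-zeroʳ b))) z≤n)
      (m≤n+m (suc m) k)

d*k≤crossings+m : ∀ {m} (G : Graph m) {c d} → ProperColouring G c → Regular G d →
  ∀ {k} {p : Fin m → Fin k} → StrictlySurjective _≡_ p → d * k ≤ crossings G p + m
d*k≤crossings+m {m} G {d = d} proper regular {k} {p} surj = begin
  d * k
    ≡⟨ trans (*-comm d k) (sym (sumFin-const k d)) ⟩
  sumFin {k} (λ _ → d)
    ≤⟨ sumFin-mono (λ i → d≤boundary+count G regular proper (part p i) (part≠∅ i)) ⟩
  sumFin (λ i → boundary G (part p i) + count (part p i))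
    ≡⟨ sumFin-+ (λ i → boundary G (part p i)) (λ i → count (part p i)) ⟩
  sumFin (λ i → boundary G (part p i)) + sumFin (λ i → count (part p i))
    ≡⟨ cong₂ _+_ (sumFin-boundary≡crossings G p) (sumFin-count-part p) ⟩
  crossings G p + m
    ∎
  where
  open ≤-Reasoning
  part≠∅ : ∀ i → NonEmpty (part p i)
  part≠∅ i = proj₁ (surj i) , dec-true (p (proj₁ (surj i)) ≟ i) (proj₂ (surj i))

8*C≤2*D⇒D≤C+m⇒C≤m×D≤2*m : ∀ {C D m} → 8 * C ≤ 2 * D → D ≤ C + m → C ≤ m × D ≤ 2 * m
8*C≤2*D⇒D≤C+m⇒C≤m×D≤2*m {C} {D} {m} 8C≤2D D≤C+m = C≤m , (begin
  D         ≤⟨ D≤C+m ⟩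
  C + m     ≤⟨ +-monoˡ-≤ m C≤m ⟩
  m + m     ≡⟨ cong (m +_) (sym (+-identityʳ m)) ⟩
  2 * m     ∎)
  where
  open ≤-Reasoning
  4C≤D : 4 * C ≤ D
  4C≤D = *-cancelˡ-≤ 2 (subst (_≤ 2 * D) (*-assoc 2 4 C) 8C≤2D)
  C≤m : C ≤ m
  C≤m = ≤-trans (m≤m+n C (2 * C)) (+-cancelˡ-≤ C (3 * C) m (≤-trans 4C≤D D≤C+m))

theorem5p3 : ∀ (n d : ℕ) (G : Graph (2 * n)) → Bipartite G → Regular G d →
    ∃ λ (k : ℕ) → ∃ λ (p : Fin (2 * n) → Fin k) →
    (∀ i → ∃ λ v → p v ≡ i)
    × (d * k ≤ 4 * n + d)
    × (∀ i → MinCutAtLeast G (part p i) d 8)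
    × (sumFin (λ i → boundary G (part p i)) ≤ 2 * n)
theorem5p3 n d G (c , proper) regular
  with k , p , surj , 8C≤2dk , dense ← Refinement.clustering G d 8
  with C≤2n , dk≤2[2n] ← 8*C≤2*D⇒D≤C+m⇒C≤m×D≤2*m 8C≤2dk (d*k≤crossings+m G proper regular surj)
  = k , p , surj
  , ≤-trans dk≤2[2n] (≤-trans (≤-reflexive (sym (*-assoc 2 2 n))) (m≤m+n (4 * n) d))
  , dense
  , subst (_≤ 2 * n) (sym (sumFin-boundary≡crossings G p)) C≤2n
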